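{- If a permutation $\pi$ contains a triple adjacency, i.e. there is a position $i$ with $\pi_{i+1}=\pi_i+1$ and $\pi_{i+2}=\pi_i+2$, then $\mu(1,\pi)=0$.
   Context: Permutations are in one-line notation, ordered by pattern containment: $\sigma\le\pi$ if $\pi$ has a subsequence in the same relative order as $\sigma$. The Möbius function on this poset is $\mu(\sigma,\sigma)=1$, $\mu(\sigma,\lambda)=0$ if $\sigma\not\le\lambda$, and $\mu(\sigma,\lambda)=-\sum_{\sigma\le z<\lambda}\mu(\sigma,z)$ for $\sigma<\lambda$. Here $1$ denotes the permutation of length one. -}

module Defs where

open import Data.Nat using (ℕ; zero; suc; _<?_)
open import Data.Nat.Properties using (_≟_)
open import Data.Integer using (ℤ; +_; -_) renaming (_+_ to _+ℤ_)
open import Data.List using (List; []; _∷_; map; filter; length; foldr; upTo; deduplicate; _++_)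
open import Data.List.Properties using (≡-dec)
open import Data.List.Membership.DecPropositional (≡-dec _≟_) using (_∈_; _∈?_)
open import Data.List.Relation.Binary.Permutation.Propositional using (_↭_)
open import Data.Bool using (Bool; true; false; if_then_else_)
open import Relation.Nullary using (¬_)
open import Relation.Nullary.Decidable using (does; ¬?)
open import Relation.Binary.PropositionalEquality using (_≡_)

-- A permutation of length n in one-line notation: a list which is a
-- rearrangement of 1,2,...,n.
IsPerm : List ℕ → Set
IsPerm π = π ↭ map suc (upTo (length π))

_≟L_ = ≡-dec _≟_

-- all subsequences (as a list, possibly with repetitions)
subseqs : List ℕ → List (List ℕ)
subseqs []       = [] ∷ []
subseqs (x ∷ xs) = let s = subseqs xs in map (x ∷_) s ++ s

std : List ℕ → List ℕ
std l = map (λ x → suc (length (filter (_<? x) l))) l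

patterns : List ℕ → List (List ℕ)
patterns π = deduplicate _≟L_ (map std (subseqs π))

_≼_ : List ℕ → List ℕ → Set
σ ≼ π = σ ∈ map std (subseqs π)

sumℤ : List ℤ → ℤ
sumℤ = foldr _+ℤ_ (+ 0)

-- Möbius function, by recursion with fuel bounding the length of λ.
-- mu σ λ = 1 if σ = λ; 0 if σ ≰ λ; otherwise
--   - Σ_{σ ≤ z < λ} mu σ z,
-- where z ranges over the (distinct) patterns of λ other than λ itself.
muF : ℕ → List ℕ → List ℕ → ℤ
muF fuel σ λ' with does (σ ≟L λ')
... | true  = + 1
... | false with does (σ ∈? map std (subseqs λ'))
...   | false = + 0
...   | true with fuel
...     | zero = + 0
...     | suc f = - sumℤ (map (muF f σ)
                     (filter (λ z → ¬? (z ≟L λ')) (filter (λ z → σ ∈? map std (subseqs z)) (patterns λ'))))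

μ : List ℕ → List ℕ → ℤ
μ σ λ' = muF (length λ') σ λ'

HasTripleAdjacency : List ℕ → Set
HasTripleAdjacency π = ∃ λ pre → ∃ λ post → ∃ λ a → π ≡ pre ++ (a ∷ suc a ∷ suc (suc a) ∷ post)
  where open import Data.Product using (∃)

-- Write π = pre · a (a+1) (a+2) · post and let π′ be π with the entry a+1 deleted.  An occurrence
-- of a pattern z of π that does not use all three entries a, a+1, a+2 gives an occurrence of z in π′
-- (if it uses a+1, trade it for the missing neighbour).  So a pattern z < π that is not a pattern of π′
-- has a triple adjacency itself, and μ(1, z) = 0 by induction on length.  Hence
-- μ(1, π) = −Σ_{1 ≤ z < π} μ(1, z) = −Σ_{1 ≤ z ≤ π′} μ(1, z) = 0, as π′ ≠ 1.  The induction runs over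
-- standardised lists, where a triple adjacency is only required up to order isomorphism.
module Submission where

open import Defs
open import Data.List using (List; []; _∷_)
open import Data.Nat using (ℕ)
open import Data.Integer using (ℤ; +_)
open import Relation.Binary.PropositionalEquality using (_≡_)

open import Data.Nat using (zero; suc; _+_; _<_; _≤_; _<?_; _⊓_; z≤n; s≤s)
open import Data.Nat.Properties
  using ( _≟_; <-irrefl; <-asym; <⇒≤; <⇒≱; ≰⇒>; ≮⇒≥; ≤∧≢⇒<; <-≤-trans; ≤-<-trans; ≤-refl; ≤-reflexive
        ; ≤-trans; ≤-pred; +-mono-≤-<; +-suc; m≤n⇒m<n∨m≡n; m≤n⇒m⊓n≡m; n<1+n; suc-injective
        ; module ≤-Reasoning)
open import Data.Nat.Induction using (<-wellFounded)
open import Induction.WellFounded using (Acc; acc)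
open import Data.Integer using (-_) renaming (_+_ to _+ℤ_)
open import Data.Integer.Properties using (+-0-isCommutativeMonoid; +-inverseˡ; +-identityˡ)
open import Data.List using ([_]; map; filter; length; _++_; upTo; applyUpTo)
open import Data.List.Properties
  using ( ≡-dec; map-∘; map-id; map-++; map-cong-local; map-id-local; map-upTo; length-map; length-++
        ; length-++-≤ʳ; ++-assoc; filter-++; filter-accept; filter-reject; filter-none)
open import Data.List.Membership.Propositional using (_∈_; _∉_)
open import Data.List.Membership.Propositional.Properties
  using ( ∈-map⁺; ∈-map⁻; ∈-++⁺ˡ; ∈-++⁺ʳ; ∈-++⁻; ∈-filter⁺; ∈-filter⁻; ∈-deduplicate⁺; ∈-deduplicate⁻
        ; ∈-upTo⁻)
open import Data.List.Membership.Propositional.Properties.WithK using (unique∧set⇒bag)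
open import Data.List.Membership.DecPropositional (≡-dec _≟_) using (_∈?_)
open import Data.List.Membership.DecPropositional _≟L_ using () renaming (_∈?_ to _∈L?_)
open import Data.List.Relation.Unary.Any using (here; there)
open import Data.List.Relation.Unary.All as All using (All; []; _∷_)
import Data.List.Relation.Unary.All.Properties as AllP
open import Data.List.Relation.Unary.AllPairs using (_∷_)
open import Data.List.Relation.Unary.Unique.Propositional using (Unique)
import Data.List.Relation.Unary.Unique.Propositional.Properties as UniqueNat
import Data.List.Relation.Unary.Unique.DecPropositional.Properties _≟L_ as UniqueList
open import Data.List.Relation.Binary.Sublist.Propositional
  using (_⊆_; []; _∷_; _∷ʳ_; ⊆-refl; ⊆-trans; from∈; lookup)
open import Data.List.Relation.Binary.Sublist.Propositional.Properties
  using (filter⁺; map⁺; ++⁺; length-mono-≤; to-≋; All-resp-⊆)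
open import Data.List.Relation.Binary.Equality.Propositional using (≋⇒≡)
open import Data.List.Relation.Binary.Permutation.Propositional using (_↭_; ↭-sym; ↭⇒↭ₛ)
import Data.List.Relation.Binary.Permutation.Propositional.Properties as ↭
open import Data.List.Relation.Binary.Permutation.Setoid.Properties using (foldr-commMonoid; Unique-resp-↭)
open import Data.List.Relation.Binary.BagAndSetEquality using (∼bag⇒↭)
open import Data.Product using (∃; ∃₂; _×_; _,_; proj₁; proj₂; <_,_>)
open import Data.Sum using (_⊎_; inj₁; inj₂)
open import Function using (_∘_; id; _⇔_; mk⇔; Equivalence)
open import Relation.Nullary using (¬_; Dec; yes; no; contradiction)
open import Relation.Nullary.Decidable using (¬?)
open import Relation.Binary.PropositionalEquality
  using (_≢_; refl; sym; trans; cong; cong₂; subst; subst₂; setoid; module ≡-Reasoning)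

-- Standardisation

countBelow : ℕ → List ℕ → ℕ
countBelow x l = length (filter (_<? x) l)

rank : List ℕ → ℕ → ℕ
rank l x = suc (countBelow x l)

countBelow-++ : ∀ x xs ys → countBelow x (xs ++ ys) ≡ countBelow x xs + countBelow x ys
countBelow-++ x xs ys = trans (cong length (filter-++ (_<? x) xs ys)) (length-++ (filter (_<? x) xs))

countBelow-mono-≤ : ∀ l {x y} → x ≤ y → countBelow x l ≤ countBelow y l
countBelow-mono-≤ l x≤y =
  length-mono-≤ (filter⁺ (_<? _) (_<? _) (λ { refl z<x → <-≤-trans z<x x≤y }) (⊆-refl {x = l}))

countBelow-mono-< : ∀ {l x y} → x < y → x ∈ l → countBelow x l < countBelow y l
countBelow-mono-< {x ∷ l} {x} {y} x<y (here refl)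
  rewrite filter-reject (_<? x) {xs = l} (<-irrefl refl) | filter-accept (_<? y) {xs = l} x<y =
  s≤s (countBelow-mono-≤ l (<⇒≤ x<y))
countBelow-mono-< {z ∷ l} {x} {y} x<y (there x∈l) =
  subst₂ _<_ (sym (countBelow-++ x [ z ] l)) (sym (countBelow-++ y [ z ] l))
    (+-mono-≤-< (countBelow-mono-≤ [ z ] (<⇒≤ x<y)) (countBelow-mono-< x<y x∈l))

rank-<-⇔ : ∀ {l x y} → y ∈ l → y < x ⇔ rank l y < rank l x
rank-<-⇔ {l} y∈l = mk⇔ (λ y<x → s≤s (countBelow-mono-< y<x y∈l))
                       (λ r → ≰⇒> (λ x≤y → <⇒≱ r (s≤s (countBelow-mono-≤ l x≤y))))

countBelow-map-proj : ∀ ps {x y} → (∀ {q} → q ∈ ps → proj₁ q < x ⇔ proj₂ q < y) →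
                      countBelow x (map proj₁ ps) ≡ countBelow y (map proj₂ ps)
countBelow-map-proj [] _ = refl
countBelow-map-proj ((u , v) ∷ ps) {x} {y} agree with u <? x | v <? y
... | yes u<x | yes v<y
  rewrite filter-accept (_<? x) {xs = map proj₁ ps} u<x | filter-accept (_<? y) {xs = map proj₂ ps} v<y =
  cong suc (countBelow-map-proj ps (agree ∘ there))
... | no u≮x | no v≮y
  rewrite filter-reject (_<? x) {xs = map proj₁ ps} u≮x | filter-reject (_<? y) {xs = map proj₂ ps} v≮y =
  countBelow-map-proj ps (agree ∘ there)
... | yes u<x | no v≮y = contradiction (Equivalence.to (agree (here refl)) u<x) v≮y
... | no u≮x | yes v<y = contradiction (Equivalence.from (agree (here refl)) v<y) u≮x

SameOrder : List (ℕ × ℕ) → Set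
SameOrder ps = ∀ {p q} → p ∈ ps → q ∈ ps → proj₁ q < proj₁ p ⇔ proj₂ q < proj₂ p

std-map-proj : ∀ ps → SameOrder ps → std (map proj₁ ps) ≡ std (map proj₂ ps)
std-map-proj ps same = begin
  map (rank (map proj₁ ps)) (map proj₁ ps)  ≡⟨ map-∘ ps ⟨
  map (rank (map proj₁ ps) ∘ proj₁) ps      ≡⟨ map-cong-local (All.tabulate λ p∈ → cong suc (agree p∈)) ⟩
  map (rank (map proj₂ ps) ∘ proj₂) ps      ≡⟨ map-∘ ps ⟩
  map (rank (map proj₂ ps)) (map proj₂ ps)  ∎
  where
  open ≡-Reasoning
  agree : ∀ {p} → p ∈ ps → countBelow (proj₁ p) (map proj₁ ps) ≡ countBelow (proj₂ p) (map proj₂ ps)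
  agree p∈ = countBelow-map-proj ps (same p∈)

std-map : ∀ (r : ℕ → ℕ) s → (∀ {x y} → x ∈ s → y ∈ s → y < x ⇔ r y < r x) → std (map r s) ≡ std s
std-map r s embed = begin
  std (map r s)                       ≡⟨ cong std (map-∘ s) ⟩
  std (map proj₂ (map < id , r > s))  ≡⟨ std-map-proj (map < id , r > s) same ⟨
  std (map proj₁ (map < id , r > s))  ≡⟨ cong std (trans (sym (map-∘ s)) (map-id s)) ⟩
  std s                               ∎
  where
  open ≡-Reasoning
  same : SameOrder (map < id , r > s)
  same p∈ q∈ with ∈-map⁻ < id , r > p∈ | ∈-map⁻ < id , r > q∈
  ... | x , x∈ , refl | y , y∈ , refl = embed x∈ y∈

std-map-rank : ∀ v t → (∀ {x} → x ∈ t → x ∈ v) → std (map (rank v) t) ≡ std t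
std-map-rank v t t⊆v = std-map (rank v) t (λ _ y∈t → rank-<-⇔ (t⊆v y∈t))

std-idempotent : ∀ s → std (std s) ≡ std s
std-idempotent s = std-map-rank s s id

Outside : ℕ → ℕ → ℕ → Set
Outside lo hi z = z < lo ⊎ hi < z

Outside-shrink : ∀ {lo hi lo′ hi′ z} → lo ≤ lo′ → hi′ ≤ hi → Outside lo hi z → Outside lo′ hi′ z
Outside-shrink lo≤lo′ _ (inj₁ z<lo) = inj₁ (<-≤-trans z<lo lo≤lo′)
Outside-shrink _ hi′≤hi (inj₂ hi<z) = inj₂ (≤-<-trans hi′≤hi hi<z)

module _ {x y : ℕ} (x≤y : x ≤ y) where

  Outside-<ˡ : ∀ {z} → Outside x y z → z < x ⇔ z < y
  Outside-<ˡ (inj₁ z<x) = mk⇔ (λ _ → <-≤-trans z<x x≤y) (λ _ → z<x)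
  Outside-<ˡ (inj₂ y<z) = mk⇔ (λ z<x → contradiction z<x (<-asym (≤-<-trans x≤y y<z)))
                               (λ z<y → contradiction z<y (<-asym y<z))

  Outside-<ʳ : ∀ {z} → Outside x y z → x < z ⇔ y < z
  Outside-<ʳ (inj₁ z<x) = mk⇔ (λ x<z → contradiction x<z (<-asym z<x))
                               (λ y<z → contradiction y<z (<-asym (<-≤-trans z<x x≤y)))
  Outside-<ʳ (inj₂ y<z) = mk⇔ (λ _ → y<z) (λ _ → ≤-<-trans x≤y y<z)

  std-replace : ∀ t₁ t₂ → All (Outside x y) (t₁ ++ t₂) → std (t₁ ++ x ∷ t₂) ≡ std (t₁ ++ y ∷ t₂)
  std-replace t₁ t₂ outside = begin
    std (t₁ ++ x ∷ t₂)  ≡⟨ cong std (unzip proj₁ λ _ → refl) ⟨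
    std (map proj₁ ps)  ≡⟨ std-map-proj ps same ⟩
    std (map proj₂ ps)  ≡⟨ cong std (unzip proj₂ λ _ → refl) ⟩
    std (t₁ ++ y ∷ t₂)  ∎
    where
    open ≡-Reasoning
    diag : ℕ → ℕ × ℕ
    diag z = z , z
    ps = map diag t₁ ++ (x , y) ∷ map diag t₂
    map-diag : ∀ (f : ℕ × ℕ → ℕ) → (∀ z → f (diag z) ≡ z) → ∀ t → map f (map diag t) ≡ t
    map-diag f f∘diag t =
      trans (sym (map-∘ t)) (trans (map-cong-local (All.tabulate λ {z} _ → f∘diag z)) (map-id t))
    unzip : ∀ (f : ℕ × ℕ → ℕ) → (∀ z → f (diag z) ≡ z) → map f ps ≡ t₁ ++ f (x , y) ∷ t₂
    unzip f f∘diag = trans (map-++ f (map diag t₁) _)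
      (cong₂ (λ u v → u ++ f (x , y) ∷ v) (map-diag f f∘diag t₁) (map-diag f f∘diag t₂))
    ∈-ps⁻ : ∀ {p} → p ∈ ps → (∃ λ z → z ∈ t₁ ++ t₂ × p ≡ diag z) ⊎ p ≡ (x , y)
    ∈-ps⁻ p∈ with ∈-++⁻ (map diag t₁) p∈
    ... | inj₁ p∈₁ with z , z∈ , refl ← ∈-map⁻ diag p∈₁ = inj₁ (z , ∈-++⁺ˡ z∈ , refl)
    ... | inj₂ (here refl) = inj₂ refl
    ... | inj₂ (there p∈₂) with z , z∈ , refl ← ∈-map⁻ diag p∈₂ = inj₁ (z , ∈-++⁺ʳ t₁ z∈ , refl)
    same : SameOrder ps
    same p∈ q∈ with ∈-ps⁻ p∈ | ∈-ps⁻ q∈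
    ... | inj₁ (_ , _ , refl) | inj₁ (_ , _ , refl) = mk⇔ id id
    ... | inj₁ (_ , z∈ , refl) | inj₂ refl = Outside-<ʳ (All.lookup outside z∈)
    ... | inj₂ refl | inj₁ (_ , z∈ , refl) = Outside-<ˡ (All.lookup outside z∈)
    ... | inj₂ refl | inj₂ refl =
      mk⇔ (λ x<x → contradiction x<x (<-irrefl refl)) (λ y<y → contradiction y<y (<-irrefl refl))

-- Subsequences and patterns

∈-subseqs⁺ : ∀ {t l} → t ⊆ l → t ∈ subseqs l
∈-subseqs⁺ [] = here refl
∈-subseqs⁺ {l = y ∷ l} (y ∷ʳ τ) = ∈-++⁺ʳ (map (y ∷_) (subseqs l)) (∈-subseqs⁺ τ)
∈-subseqs⁺ (refl ∷ τ) = ∈-++⁺ˡ (∈-map⁺ (_ ∷_) (∈-subseqs⁺ τ))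

∈-subseqs⁻ : ∀ l {t} → t ∈ subseqs l → t ⊆ l
∈-subseqs⁻ [] (here refl) = []
∈-subseqs⁻ (x ∷ l) t∈ with ∈-++⁻ (map (x ∷_) (subseqs l)) t∈
... | inj₁ t∈₁ with t′ , t′∈ , refl ← ∈-map⁻ (x ∷_) t∈₁ = refl ∷ ∈-subseqs⁻ l t′∈
... | inj₂ t∈₂ = x ∷ʳ ∈-subseqs⁻ l t∈₂

⊆-++⁻ : ∀ {A : Set} (l₁ : List A) {l₂ t} → t ⊆ l₁ ++ l₂ → ∃₂ λ t₁ t₂ → t₁ ⊆ l₁ × t₂ ⊆ l₂ × t ≡ t₁ ++ t₂
⊆-++⁻ [] {t = t} τ = [] , t , [] , τ , refl
⊆-++⁻ (x ∷ l₁) (.x ∷ʳ τ) with t₁ , t₂ , τ₁ , τ₂ , refl ← ⊆-++⁻ l₁ τ = t₁ , t₂ , x ∷ʳ τ₁ , τ₂ , refl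
⊆-++⁻ (x ∷ l₁) (refl ∷ τ) with t₁ , t₂ , τ₁ , τ₂ , refl ← ⊆-++⁻ l₁ τ = x ∷ t₁ , t₂ , refl ∷ τ₁ , τ₂ , refl

⊆-map⁻ : ∀ {A B : Set} (f : A → B) l {u} → u ⊆ map f l → ∃ λ t → t ⊆ l × u ≡ map f t
⊆-map⁻ f [] [] = [] , [] , refl
⊆-map⁻ f (x ∷ l) (._ ∷ʳ τ) with t , τ′ , refl ← ⊆-map⁻ f l τ = t , x ∷ʳ τ′ , refl
⊆-map⁻ f (x ∷ l) (refl ∷ τ) with t , τ′ , refl ← ⊆-map⁻ f l τ = x ∷ t , refl ∷ τ′ , refl

⊆⇒std-≼ : ∀ {t l} → t ⊆ l → std t ≼ l
⊆⇒std-≼ τ = ∈-map⁺ std (∈-subseqs⁺ τ)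

∈-patterns⁺ : ∀ {t l} → t ⊆ l → std t ∈ patterns l
∈-patterns⁺ τ = ∈-deduplicate⁺ _≟L_ (⊆⇒std-≼ τ)

∈-patterns⁻ : ∀ l {u} → u ∈ patterns l → ∃ λ t → t ⊆ l × u ≡ std t
∈-patterns⁻ l u∈ with t , t∈ , u≡ ← ∈-map⁻ std (∈-deduplicate⁻ _≟L_ (map std (subseqs l)) u∈) =
  t , ∈-subseqs⁻ l t∈ , u≡

∈-patterns-std⁺ : ∀ {t v} → t ⊆ v → std t ∈ patterns (std v)
∈-patterns-std⁺ {t} {v} τ =
  subst (_∈ patterns (std v)) (std-map-rank v t (lookup τ)) (∈-patterns⁺ (map⁺ (rank v) τ))

patterns-std-⊆ : ∀ {v w u} → v ⊆ w → u ∈ patterns (std v) → u ∈ patterns w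
patterns-std-⊆ {v} {w} v⊆w u∈ with t , τ , refl ← ∈-patterns⁻ (std v) u∈
  with t′ , τ′ , refl ← ⊆-map⁻ (rank v) v τ =
  subst (_∈ patterns w) (sym (std-map-rank v t′ (lookup τ′))) (∈-patterns⁺ (⊆-trans τ′ v⊆w))

Standard : List ℕ → Set
Standard w = ∃ λ s → w ≡ std s

std-standard : ∀ {w} → Standard w → std w ≡ w
std-standard (s , refl) = std-idempotent s

length-std : ∀ t → length (std t) ≡ length t
length-std t = length-map (rank t) t

patterns-length : ∀ l {u} → u ∈ patterns l → length u ≤ length l
patterns-length l u∈ with t , τ , refl ← ∈-patterns⁻ l u∈ =
  subst (_≤ length l) (sym (length-std t)) (length-mono-≤ τ)

patterns-standard : ∀ l {u} → u ∈ patterns l → Standard u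
patterns-standard l u∈ with t , _ , u≡ ← ∈-patterns⁻ l u∈ = t , u≡

patterns-proper-shorter : ∀ {w u} → Standard w → u ∈ patterns w → u ≢ w → length u < length w
patterns-proper-shorter {w} std-w u∈ u≢w with t , τ , refl ← ∈-patterns⁻ w u∈
  with m≤n⇒m<n∨m≡n (length-mono-≤ τ)
... | inj₁ |t|<|w| = subst (_< length w) (sym (length-std t)) |t|<|w|
... | inj₂ |t|≡|w| = contradiction (trans (cong std (≋⇒≡ (to-≋ |t|≡|w| τ))) (std-standard std-w)) u≢w

-- Sums and permutations of lists

sumℤ-↭ : ∀ {xs ys : List ℤ} → xs ↭ ys → sumℤ xs ≡ sumℤ ys
sumℤ-↭ p = foldr-commMonoid (setoid ℤ) +-0-isCommutativeMonoid (↭⇒↭ₛ p)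

sumℤ-map-filter : ∀ {A : Set} {P : A → Set} (P? : ∀ x → Dec (P x)) (f : A → ℤ) xs →
                  (∀ {x} → x ∈ xs → ¬ P x → f x ≡ + 0) → sumℤ (map f (filter P? xs)) ≡ sumℤ (map f xs)
sumℤ-map-filter P? f [] _ = refl
sumℤ-map-filter P? f (x ∷ xs) vanish with P? x
... | yes _ = cong (f x +ℤ_) (sumℤ-map-filter P? f xs (vanish ∘ there))
... | no ¬Px = begin
  sumℤ (map f (filter P? xs))  ≡⟨ sumℤ-map-filter P? f xs (vanish ∘ there) ⟩
  sumℤ (map f xs)              ≡⟨ +-identityˡ _ ⟨
  + 0 +ℤ sumℤ (map f xs)       ≡⟨ cong (_+ℤ sumℤ (map f xs)) (vanish (here refl) ¬Px) ⟨
  f x +ℤ sumℤ (map f xs)       ∎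
  where open ≡-Reasoning

↭-unique-set : ∀ {A : Set} {xs ys : List A} → Unique xs → Unique ys → (∀ {z} → z ∈ xs ⇔ z ∈ ys) → xs ↭ ys
↭-unique-set xs! ys! same = ∼bag⇒↭ (unique∧set⇒bag xs! ys! same)

↭-extract : ∀ {xs : List (List ℕ)} {v} → Unique xs → v ∈ xs → xs ↭ v ∷ filter (λ z → ¬? (z ≟L v)) xs
↭-extract {xs} {v} xs! v∈xs = ↭-unique-set xs! (All.tabulate v∉ ∷ UniqueList.filter⁺ _ xs!) (mk⇔ to from)
  where
  v∉ : ∀ {z} → z ∈ filter (λ z → ¬? (z ≟L v)) xs → v ≢ z
  v∉ z∈ refl = proj₂ (∈-filter⁻ (λ z → ¬? (z ≟L v)) {xs = xs} z∈) refl
  to : ∀ {z} → z ∈ xs → z ∈ v ∷ filter (λ z → ¬? (z ≟L v)) xs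
  to {z} z∈ with z ≟L v
  ... | yes refl = here refl
  ... | no z≢v = there (∈-filter⁺ (λ z → ¬? (z ≟L v)) z∈ z≢v)
  from : ∀ {z} → z ∈ v ∷ filter (λ z → ¬? (z ≟L v)) xs → z ∈ xs
  from (here refl) = v∈xs
  from (there z∈) = proj₁ (∈-filter⁻ (λ z → ¬? (z ≟L v)) {xs = xs} z∈)

-- The Möbius function on the interval [1, w]

μ₁ : List ℕ → ℤ
μ₁ = μ [ 1 ]

[1]≼? : ∀ z → Dec ([ 1 ] ≼ z)
[1]≼? z = [ 1 ] ∈? map std (subseqs z)

interval strictInterval : List ℕ → List (List ℕ)
interval w = filter [1]≼? (patterns w)
strictInterval w = filter (λ z → ¬? (z ≟L w)) (interval w)

interval-unique : ∀ w → Unique (interval w)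
interval-unique w = UniqueList.filter⁺ [1]≼? (UniqueList.deduplicate-! (map std (subseqs w)))

strictInterval-unique : ∀ w → Unique (strictInterval w)
strictInterval-unique w = UniqueList.filter⁺ _ (interval-unique w)

∈-strictInterval⁻ : ∀ {w u} → u ∈ strictInterval w → u ∈ patterns w × u ≢ w × [ 1 ] ≼ u
∈-strictInterval⁻ {w} u∈ with u∈I , u≢w ← ∈-filter⁻ (λ z → ¬? (z ≟L w)) u∈
  with u∈P , [1]≼u ← ∈-filter⁻ [1]≼? {xs = patterns w} u∈I = u∈P , u≢w , [1]≼u

∈-strictInterval⁺ : ∀ {w u} → u ∈ patterns w → u ≢ w → [ 1 ] ≼ u → u ∈ strictInterval w
∈-strictInterval⁺ {w} u∈P u≢w [1]≼u = ∈-filter⁺ (λ z → ¬? (z ≟L w)) (∈-filter⁺ [1]≼? u∈P [1]≼u) u≢w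

std-singleton : ∀ x → std [ x ] ≡ [ 1 ]
std-singleton x = cong (λ l → suc (length l) ∷ []) (filter-reject (_<? x) {xs = []} (<-irrefl refl))

[1]≼ : ∀ {x l} → x ∈ l → [ 1 ] ≼ l
[1]≼ {x} {l} x∈l = subst (_≼ l) (std-singleton x) (⊆⇒std-≼ (from∈ x∈l))

strictInterval-shorter : ∀ {w u} → Standard w → u ∈ strictInterval w → length u < length w
strictInterval-shorter {w} std-w u∈ with u∈P , u≢w , _ ← ∈-strictInterval⁻ {w} u∈ =
  patterns-proper-shorter std-w u∈P u≢w

strictInterval-standard : ∀ {w u} → u ∈ strictInterval w → Standard u
strictInterval-standard {w} u∈ = patterns-standard w (proj₁ (∈-strictInterval⁻ {w} u∈))

muF-fuel : ∀ f g w → Standard w → length w ≤ f → length w ≤ g → muF f [ 1 ] w ≡ muF g [ 1 ] w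
muF-fuel f       g       []      _ _ _ = refl
muF-fuel zero    g       (_ ∷ _) _ () _
muF-fuel (suc f) zero    (_ ∷ _) _ _ ()
muF-fuel (suc f) (suc g) w std-w |w|≤f |w|≤g with [ 1 ] ≟L w
... | yes _ = refl
... | no _ with [ 1 ] ∈? map std (subseqs w)
...   | no _ = refl
...   | yes _ = cong (-_ ∘ sumℤ) (map-cong-local (All.tabulate λ u∈ →
          muF-fuel f g _ (strictInterval-standard {w} u∈) (shorter u∈ |w|≤f) (shorter u∈ |w|≤g)))
  where
  shorter : ∀ {u n} → u ∈ strictInterval w → length w ≤ suc n → length u ≤ n
  shorter u∈ |w|≤n = ≤-pred (<-≤-trans (strictInterval-shorter std-w u∈) |w|≤n)

muF-unfold : ∀ f w → w ≢ [ 1 ] → [ 1 ] ≼ w →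
             muF (suc f) [ 1 ] w ≡ - sumℤ (map (muF f [ 1 ]) (strictInterval w))
muF-unfold f w w≢[1] [1]≼w with [ 1 ] ≟L w
... | yes [1]≡w = contradiction (sym [1]≡w) w≢[1]
... | no _ with [ 1 ] ∈? map std (subseqs w)
...   | no [1]⋠w = contradiction [1]≼w [1]⋠w
...   | yes _ = refl

μ₁-unfold : ∀ {w} → Standard w → w ≢ [ 1 ] → [ 1 ] ≼ w → μ₁ w ≡ - sumℤ (map μ₁ (strictInterval w))
μ₁-unfold {[]} _ _ (here ())
μ₁-unfold {[]} _ _ (there ())
μ₁-unfold {w@(_ ∷ w′)} std-w w≢[1] [1]≼w =
  trans (muF-unfold (length w′) w w≢[1] [1]≼w) (cong (-_ ∘ sumℤ) (map-cong-local (All.tabulate λ {u} u∈ →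
    muF-fuel (length w′) (length u) u (strictInterval-standard {w} u∈)
             (≤-pred (strictInterval-shorter std-w u∈)) ≤-refl)))

sum-μ₁-interval : ∀ s → 2 ≤ length s → sumℤ (map μ₁ (interval (std s))) ≡ + 0
sum-μ₁-interval (_ ∷ []) (s≤s ())
sum-μ₁-interval s@(_ ∷ _ ∷ _) _ = begin
  sumℤ (map μ₁ (interval v))  ≡⟨ sumℤ-↭ (↭.map⁺ μ₁ (↭-extract (interval-unique v) v∈I)) ⟩
  μ₁ v +ℤ Σ                   ≡⟨ cong (_+ℤ Σ) (μ₁-unfold (s , refl) (λ ()) [1]≼v) ⟩
  - Σ +ℤ Σ                    ≡⟨ +-inverseˡ Σ ⟩
  + 0                         ∎
  where
  open ≡-Reasoning
  v = std s
  Σ = sumℤ (map μ₁ (strictInterval v))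
  [1]≼v : [ 1 ] ≼ v
  [1]≼v = [1]≼ {l = v} (here refl)
  v∈I : v ∈ interval v
  v∈I = ∈-filter⁺ [1]≼? (subst (_∈ patterns v) (std-idempotent s) (∈-patterns⁺ ⊆-refl)) [1]≼v

-- Triple adjacencies

-- A triple adjacency up to order isomorphism: consecutive entries a < b < c and no other entry in [a, c].
record TripleAdjacency (w : List ℕ) : Set where
  field
    pre post : List ℕ
    a b c : ℕ
    w≡ : w ≡ pre ++ a ∷ b ∷ c ∷ post
    a<b : a < b
    b<c : b < c
    outside : All (Outside a c) (pre ++ post)

std-tripleAdjacency : ∀ {a b c} t₁ t₃ → a < b → b < c → All (Outside a c) (t₁ ++ t₃) →
                      TripleAdjacency (std (t₁ ++ a ∷ b ∷ c ∷ t₃))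
std-tripleAdjacency {a} {b} {c} t₁ t₃ a<b b<c outside = record
  { pre = map r t₁ ; post = map r t₃ ; a = r a ; b = r b ; c = r c
  ; w≡ = map-++ r t₁ (a ∷ b ∷ c ∷ t₃)
  ; a<b = r-< (∈t (here refl)) a<b
  ; b<c = r-< (∈t (there (here refl))) b<c
  ; outside = subst (All _) (map-++ r t₁ t₃)
                (AllP.map⁺ (All.tabulate λ z∈ → r-outside (All.lookup outside z∈) (∈t′ z∈)))
  }
  where
  t = t₁ ++ a ∷ b ∷ c ∷ t₃
  r = rank t
  ∈t : ∀ {z} → z ∈ a ∷ b ∷ c ∷ t₃ → z ∈ t
  ∈t = ∈-++⁺ʳ t₁
  ∈t′ : ∀ {z} → z ∈ t₁ ++ t₃ → z ∈ t
  ∈t′ = lookup (++⁺ (⊆-refl {x = t₁}) (a ∷ʳ b ∷ʳ c ∷ʳ ⊆-refl))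
  r-< : ∀ {y x} → y ∈ t → y < x → r y < r x
  r-< y∈ = Equivalence.to (rank-<-⇔ y∈)
  r-outside : ∀ {z} → Outside a c z → z ∈ t → Outside (r a) (r c) (r z)
  r-outside (inj₁ z<a) z∈ = inj₁ (r-< z∈ z<a)
  r-outside (inj₂ c<z) _ = inj₂ (r-< (∈t (there (there (here refl)))) c<z)

module _ {w} (T : TripleAdjacency w) where
  open TripleAdjacency T

  deleteMiddle : List ℕ
  deleteMiddle = pre ++ a ∷ c ∷ post

  deleteMiddle-⊆ : deleteMiddle ⊆ w
  deleteMiddle-⊆ = subst (deleteMiddle ⊆_) (sym w≡) (++⁺ (⊆-refl {x = pre}) (refl ∷ b ∷ʳ ⊆-refl))

  length-deleteMiddle : suc (length deleteMiddle) ≡ length w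
  length-deleteMiddle = begin
    suc (length (pre ++ a ∷ c ∷ post))        ≡⟨ cong suc (length-++ pre) ⟩
    suc (length pre + length (a ∷ c ∷ post))  ≡⟨ +-suc (length pre) _ ⟨
    length pre + length (a ∷ b ∷ c ∷ post)    ≡⟨ length-++ pre ⟨
    length (pre ++ a ∷ b ∷ c ∷ post)          ≡⟨ cong length w≡ ⟨
    length w                                  ∎
    where open ≡-Reasoning

  2≤length-deleteMiddle : 2 ≤ length deleteMiddle
  2≤length-deleteMiddle = ≤-trans (s≤s (s≤s z≤n)) (length-++-≤ʳ (a ∷ c ∷ post) {pre})

  w≢[1] : w ≢ [ 1 ]
  w≢[1] w≡[1] = contradiction (subst (λ v → 3 ≤ length v) w≡[1] 3≤length-w) λ { (s≤s ()) }
    where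
    3≤length-w : 3 ≤ length w
    3≤length-w = subst (3 ≤_) length-deleteMiddle (s≤s 2≤length-deleteMiddle)

  a∈w : a ∈ w
  a∈w = subst (a ∈_) (sym w≡) (∈-++⁺ʳ pre (here refl))

  replace-b-by-c : ∀ {t₁ t₃} → t₁ ⊆ pre → t₃ ⊆ post → std (t₁ ++ a ∷ b ∷ t₃) ≡ std (t₁ ++ a ∷ c ∷ t₃)
  replace-b-by-c {t₁} {t₃} τ₁ τ₃ = begin
    std (t₁ ++ a ∷ b ∷ t₃)         ≡⟨ cong std (++-assoc t₁ [ a ] _) ⟨
    std ((t₁ ++ [ a ]) ++ b ∷ t₃)  ≡⟨ std-replace (<⇒≤ b<c) (t₁ ++ [ a ]) t₃ outside-bc ⟩
    std ((t₁ ++ [ a ]) ++ c ∷ t₃)  ≡⟨ cong std (++-assoc t₁ [ a ] _) ⟩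
    std (t₁ ++ a ∷ c ∷ t₃)         ∎
    where
    open ≡-Reasoning
    shrink : ∀ {z} → Outside a c z → Outside b c z
    shrink = Outside-shrink (<⇒≤ a<b) ≤-refl
    outside-bc : All (Outside b c) ((t₁ ++ [ a ]) ++ t₃)
    outside-bc = All-resp-⊆ (++⁺ (++⁺ τ₁ (refl ∷ [])) τ₃)
      (AllP.++⁺ (AllP.++⁺ (All.map shrink (AllP.++⁻ˡ pre outside)) (inj₁ a<b ∷ []))
                (All.map shrink (AllP.++⁻ʳ pre outside)))

  replace-b-by-a : ∀ {t₁ t₃} → t₁ ⊆ pre → t₃ ⊆ c ∷ post → std (t₁ ++ b ∷ t₃) ≡ std (t₁ ++ a ∷ t₃)
  replace-b-by-a {t₁} {t₃} τ₁ τ₃ = sym (std-replace (<⇒≤ a<b) t₁ t₃ outside-ab)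
    where
    shrink : ∀ {z} → Outside a c z → Outside a b z
    shrink = Outside-shrink ≤-refl (<⇒≤ b<c)
    outside-ab : All (Outside a b) (t₁ ++ t₃)
    outside-ab = All-resp-⊆ (++⁺ τ₁ τ₃)
      (AllP.++⁺ (All.map shrink (AllP.++⁻ˡ pre outside)) (inj₂ b<c ∷ All.map shrink (AllP.++⁻ʳ pre outside)))

  std-⊆-dichotomy : ∀ {t} → t ⊆ w → TripleAdjacency (std t) ⊎ std t ∈ patterns (std deleteMiddle)
  std-⊆-dichotomy τ with t₁ , _ , τ₁ , τ₂ , refl ← ⊆-++⁻ pre (subst (_ ⊆_) w≡ τ) with τ₂
  ... | refl ∷ refl ∷ refl ∷ τ₃ = inj₁ (std-tripleAdjacency t₁ _ a<b b<c (All-resp-⊆ (++⁺ τ₁ τ₃) outside))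
  ... | refl ∷ refl ∷ _ ∷ʳ τ₃ =
    inj₂ (subst (_∈ _) (sym (replace-b-by-c τ₁ τ₃)) (∈-patterns-std⁺ (++⁺ τ₁ (refl ∷ refl ∷ τ₃))))
  ... | refl ∷ _ ∷ʳ τ₃ = inj₂ (∈-patterns-std⁺ (++⁺ τ₁ (refl ∷ τ₃)))
  ... | _ ∷ʳ refl ∷ τ₃ =
    inj₂ (subst (_∈ _) (sym (replace-b-by-a τ₁ τ₃)) (∈-patterns-std⁺ (++⁺ τ₁ (refl ∷ τ₃))))
  ... | _ ∷ʳ _ ∷ʳ τ₃ = inj₂ (∈-patterns-std⁺ (++⁺ τ₁ (a ∷ʳ τ₃)))

  non-pattern-tripleAdjacency : ∀ {u} → u ∈ patterns w → u ∉ patterns (std deleteMiddle) → TripleAdjacency u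
  non-pattern-tripleAdjacency u∈ u∉ with t , τ , refl ← ∈-patterns⁻ w u∈ with std-⊆-dichotomy τ
  ... | inj₁ triple = triple
  ... | inj₂ u∈′ = contradiction u∈′ u∉

  strictInterval-∩-patterns :
    filter (_∈L? patterns (std deleteMiddle)) (strictInterval w) ↭ interval (std deleteMiddle)
  strictInterval-∩-patterns =
    ↭-unique-set (UniqueList.filter⁺ _ (strictInterval-unique w)) (interval-unique w′) (mk⇔ to from)
    where
    w′ = std deleteMiddle
    to : ∀ {z} → z ∈ filter (_∈L? patterns w′) (strictInterval w) → z ∈ interval w′
    to z∈ with z∈I , z∈P′ ← ∈-filter⁻ (_∈L? patterns w′) {xs = strictInterval w} z∈ =
      ∈-filter⁺ [1]≼? z∈P′ (proj₂ (proj₂ (∈-strictInterval⁻ {w} z∈I)))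
    from : ∀ {z} → z ∈ interval w′ → z ∈ filter (_∈L? patterns w′) (strictInterval w)
    from {z} z∈ with z∈P′ , [1]≼z ← ∈-filter⁻ [1]≼? {xs = patterns w′} z∈ =
      ∈-filter⁺ (_∈L? patterns w′) (∈-strictInterval⁺ (patterns-std-⊆ deleteMiddle-⊆ z∈P′) z≢w [1]≼z) z∈P′
      where
      z≢w : z ≢ w
      z≢w refl = <-irrefl refl (begin-strict
        length w             ≤⟨ patterns-length w′ z∈P′ ⟩
        length w′            ≡⟨ length-std deleteMiddle ⟩
        length deleteMiddle  <⟨ ≤-reflexive length-deleteMiddle ⟩
        length w             ∎)
        where open ≤-Reasoning

μ₁-tripleAdjacency : ∀ {w} → Acc _<_ (length w) → Standard w → TripleAdjacency w → μ₁ w ≡ + 0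
μ₁-tripleAdjacency {w} (acc shorter) std-w T = begin
  μ₁ w                     ≡⟨ μ₁-unfold std-w (w≢[1] T) ([1]≼ {l = w} (a∈w T)) ⟩
  - Σ (strictInterval w)   ≡⟨ cong -_ (sumℤ-map-filter (_∈L? patterns w′) μ₁ _ vanish) ⟨
  - Σ (filter (_∈L? patterns w′) (strictInterval w))
                           ≡⟨ cong -_ (sumℤ-↭ (↭.map⁺ μ₁ (strictInterval-∩-patterns T))) ⟩
  - Σ (interval w′)        ≡⟨ cong -_ (sum-μ₁-interval (deleteMiddle T) (2≤length-deleteMiddle T)) ⟩
  + 0                      ∎
  where
  open ≡-Reasoning
  Σ : List (List ℕ) → ℤ
  Σ zs = sumℤ (map μ₁ zs)
  w′ = std (deleteMiddle T)
  vanish : ∀ {u} → u ∈ strictInterval w → u ∉ patterns w′ → μ₁ u ≡ + 0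
  vanish {u} u∈ u∉ with u∈P , _ ← ∈-strictInterval⁻ {w} u∈ =
    μ₁-tripleAdjacency (shorter (strictInterval-shorter std-w u∈)) (strictInterval-standard {w} u∈)
                       (non-pattern-tripleAdjacency T u∈P u∉)

-- Permutations

countBelow-map-suc : ∀ x l → countBelow (suc x) (map suc l) ≡ countBelow x l
countBelow-map-suc x [] = refl
countBelow-map-suc x (y ∷ l) with y <? x
... | yes y<x
  rewrite filter-accept (_<? suc x) {xs = map suc l} (s≤s y<x) | filter-accept (_<? x) {xs = l} y<x =
  cong suc (countBelow-map-suc x l)
... | no y≮x
  rewrite filter-reject (_<? suc x) {xs = map suc l} (y≮x ∘ ≤-pred) | filter-reject (_<? x) {xs = l} y≮x =
  countBelow-map-suc x l

countBelow-upTo : ∀ x n → countBelow x (upTo n) ≡ x ⊓ n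
countBelow-upTo zero    n       = cong length (filter-none (_<? 0) {xs = upTo n} (All.tabulate λ _ ()))
countBelow-upTo (suc x) zero    = refl
countBelow-upTo (suc x) (suc n)
  rewrite filter-accept (_<? suc x) {xs = applyUpTo suc n} (s≤s z≤n) = cong suc (begin
    countBelow (suc x) (applyUpTo suc n)   ≡⟨ cong (countBelow (suc x)) (map-upTo suc n) ⟨
    countBelow (suc x) (map suc (upTo n))  ≡⟨ countBelow-map-suc x (upTo n) ⟩
    countBelow x (upTo n)                  ≡⟨ countBelow-upTo x n ⟩
    x ⊓ n                                  ∎)
  where open ≡-Reasoning

std-perm : ∀ {π} → IsPerm π → std π ≡ π
std-perm {π} perm = map-id-local (All.tabulate rank≡)
  where
  n = length π
  rank≡ : ∀ {x} → x ∈ π → rank π x ≡ x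
  rank≡ x∈π with k , k∈ , refl ← ∈-map⁻ suc (↭.∈-resp-↭ perm x∈π) = cong suc (begin
    countBelow (suc k) π                   ≡⟨ ↭.↭-length (↭.filter-↭ (_<? suc k) perm) ⟩
    countBelow (suc k) (map suc (upTo n))  ≡⟨ countBelow-map-suc k (upTo n) ⟩
    countBelow k (upTo n)                  ≡⟨ countBelow-upTo k n ⟩
    k ⊓ n                                  ≡⟨ m≤n⇒m⊓n≡m (<⇒≤ (∈-upTo⁻ k∈)) ⟩
    k                                      ∎)
    where open ≡-Reasoning

perm-unique : ∀ {π} → IsPerm π → Unique π
perm-unique {π} perm =
  Unique-resp-↭ (setoid ℕ) (↭⇒↭ₛ (↭-sym perm)) (UniqueNat.map⁺ suc-injective (UniqueNat.upTo⁺ (length π)))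

Outside-≢ : ∀ {a z} → z ≢ a → z ≢ suc a → z ≢ suc (suc a) → Outside a (suc (suc a)) z
Outside-≢ {a} {z} z≢a z≢a+1 z≢a+2 with z <? a
... | yes z<a = inj₁ z<a
... | no z≮a = inj₂ (≤∧≢⇒< (≤∧≢⇒< (≤∧≢⇒< (≮⇒≥ z≮a) (z≢a ∘ sym)) (z≢a+1 ∘ sym)) (z≢a+2 ∘ sym))

perm-tripleAdjacency : ∀ {π} → IsPerm π → HasTripleAdjacency π → TripleAdjacency π
perm-tripleAdjacency {π} perm (pre , post , a , π≡) = record
  { pre = pre ; post = post ; a = a ; b = suc a ; c = suc (suc a) ; w≡ = π≡
  ; a<b = n<1+n a ; b<c = n<1+n (suc a)
  ; outside = outside
  }
  where
  triple-first : Unique (a ∷ suc a ∷ suc (suc a) ∷ pre ++ post)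
  triple-first = Unique-resp-↭ (setoid ℕ) (↭⇒↭ₛ (↭.shifts pre (a ∷ suc a ∷ suc (suc a) ∷ [])))
                               (subst Unique π≡ (perm-unique perm))
  outside : All (Outside a (suc (suc a))) (pre ++ post)
  outside with a≢ ∷ a+1≢ ∷ a+2≢ ∷ _ ← triple-first = All.tabulate λ z∈ →
    Outside-≢ (All.lookup a≢ (there (there z∈)) ∘ sym) (All.lookup a+1≢ (there z∈) ∘ sym)
              (All.lookup a+2≢ z∈ ∘ sym)

lemma1 : (π : List ℕ) → IsPerm π → HasTripleAdjacency π → μ (1 ∷ []) π ≡ + 0
lemma1 π perm adjacency = μ₁-tripleAdjacency (<-wellFounded (length π)) (π , sym (std-perm perm))
                                             (perm-tripleAdjacency perm adjacency)
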